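{- Let $a,b\in\mathbb{Z}$ and let $n\ge 1$ be an integer. Let $D=\{(x,y)\in\mathbb{Z}^2 : a-b\le x-y\le a-b+n+1\}$ and $F=\{(x,y)\in D: x\ge a,\ y\le b\}$. Let $t$ be a partial $\mathrm{SL}_2$-tiling defined on $F$ such that $t_{ab}=1$ and $t_{xy}=1$ for every $(x,y)\in F$ with $x-y=a-b+n+1$. Then there is a friese defined on $D$ which agrees with $t$ on $F$.
   Context: For $E\subseteq\mathbb{Z}^2$, a partial $\mathrm{SL}_2$-tiling defined on $E$ is a map $E\to\{1,2,3,\dots\}$, $(i,j)\mapsto t_{ij}$, such that $t_{ij}t_{i+1,j+1}-t_{i,j+1}t_{i+1,j}=1$ whenever all four points $(i,j),(i,j+1),(i+1,j),(i+1,j+1)$ lie in $E$. For integers $m<M$, a friese on the diagonal band $D=\{(x,y)\in\mathbb{Z}^2: m\le x-y\le M\}$ is a partial $\mathrm{SL}_2$-tiling defined on $D$ with $t_{xy}=1$ whenever $x-y=m$ or $x-y=M$. (Here $x$ is the row index increasing downward and $y$ the column index increasing to the right; $F$ is the triangle with apex $(a,b)$ on the upper edge of $D$ and base on the lower edge.) -}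

module Defs where

open import Data.Nat using (ℕ; _+_; _*_; _≥_)
open import Data.Integer using (ℤ; +_; _-_; _≤_) renaming (_+_ to _+ℤ_)
open import Relation.Binary.PropositionalEquality using (_≡_)
open import Data.Product using (_×_)

Subset² : Set₁
Subset² = ℤ → ℤ → Set

-- A partial SL₂-tiling defined on E, represented as a map ℤ² → ℕ whose
-- values outside E are irrelevant (only values on E are ever constrained).
-- Values on E are positive integers, and the adjacent 2×2 determinant is 1
-- whenever all four points lie in E.  t i j t(i+1)(j+1) - t i (j+1) t (i+1) j = 1
-- is written in ℕ as  t i j * t (i+1)(j+1) ≡ 1 + t i (j+1) * t (i+1) j.
IsPartialSL2Tiling : Subset² → (ℤ → ℤ → ℕ) → Set
IsPartialSL2Tiling E t =
  (∀ i j → E i j → t i j ≥ 1) ×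
  (∀ i j → E i j → E i (j +ℤ + 1) → E (i +ℤ + 1) j → E (i +ℤ + 1) (j +ℤ + 1) →
     t i j * t (i +ℤ + 1) (j +ℤ + 1) ≡ 1 + t i (j +ℤ + 1) * t (i +ℤ + 1) j)

Band : ℤ → ℤ → Subset²
Band m M x y = (m ≤ x - y) × (x - y ≤ M)

IsFriese : ℤ → ℤ → (ℤ → ℤ → ℕ) → Set
IsFriese m M t =
  IsPartialSL2Tiling (Band m M) t ×
  (∀ x y → x - y ≡ m → t x y ≡ 1) ×
  (∀ x y → x - y ≡ M → t x y ≡ 1)

module Submission where

-- Write N = n + 1 and T u v = t (a + u) (b - v); then F is the triangle u + v ≤ N,
-- T is an SL₂-triangle with a 1 at the apex (u,v) = (0,0) and 1s on the hypotenuse u + v = N.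
-- The friese is obtained by gluing to this triangle its glide reflection: in coordinates
-- (d , r), where d = x - y - (a - b) is the row of the band and r is x - a modulo N + 2,
-- the entry is T r (d - r) when r ≤ d and T (r - d - 1) (N + 1 - r) otherwise.
--   * PlaneAlgebra: determinants of integer plane vectors, the Plücker relation, and the fact
--     that an array obeying the diamond rule is determined by its first row and column.
--   * TriangleSeam: the triangle is represented as T u v = det (α u , γ v) for vectors built
--     from its edges; the hypotenuse of 1s forces α and γ to coincide along it, which yields
--     the seam identity T k 0 · T 0 j = 1 + T (k+1) 0 · T 0 (j+1) for k + j = N.
--   * Cyclic, GlideExtension: the glued pattern on rows 0..N and positions modulo N + 2; the
--     diamond rule across the two seams is exactly the seam identity.
--   * BandFriese, Corner: the pattern, read off along the band, is a friese; on the corner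
--     triangle it is t itself.

open import Defs
open import Data.Nat as ℕ using (ℕ; zero; suc; z≤n; s≤s)
open import Data.Integer using (ℤ)
import Data.Nat.Properties as ℕP
open import Data.Product using (_×_; _,_; Σ; Σ-syntax; ∃-syntax; proj₁; proj₂)
open import Relation.Binary.PropositionalEquality

module PlaneAlgebra where
  open import Data.Integer using (ℤ; +_; 0ℤ; _+_; _-_; _*_; ≢-nonZero)
  import Data.Integer.Properties as ℤP
  open import Data.Integer.Tactic.RingSolver using (solve-∀)

  V2 : Set
  V2 = ℤ × ℤ

  det : V2 → V2 → ℤ
  det (p₁ , p₂) (q₁ , q₂) = p₁ * q₂ - p₂ * q₁

  plücker : ∀ p q r s → det p r * det q s - det p s * det q r ≡ det p q * det r s
  plücker (p₁ , p₂) (q₁ , q₂) (r₁ , r₂) (s₁ , s₂) = expanded p₁ p₂ q₁ q₂ r₁ r₂ s₁ s₂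
    where
    expanded : ∀ p₁ p₂ q₁ q₂ r₁ r₂ s₁ s₂ →
      (p₁ * r₂ - p₂ * r₁) * (q₁ * s₂ - q₂ * s₁) - (p₁ * s₂ - p₂ * s₁) * (q₁ * r₂ - q₂ * r₁)
      ≡ (p₁ * q₂ - p₂ * q₁) * (r₁ * s₂ - r₂ * s₁)
    expanded = solve-∀

  det-swap-both : ∀ p q r s → det p q * det r s ≡ det q p * det s r
  det-swap-both (p₁ , p₂) (q₁ , q₂) (r₁ , r₂) (s₁ , s₂) = expanded p₁ p₂ q₁ q₂ r₁ r₂ s₁ s₂
    where
    expanded : ∀ p₁ p₂ q₁ q₂ r₁ r₂ s₁ s₂ →
      (p₁ * q₂ - p₂ * q₁) * (r₁ * s₂ - r₂ * s₁) ≡ (q₁ * p₂ - q₂ * p₁) * (s₁ * r₂ - s₂ * r₁)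
    expanded = solve-∀

  -- Cramer's rule: det(p,q) · r = det(p,r) · q - det(q,r) · p.  Hence if (p,q) is a unimodular
  -- basis, a vector r with det(p,r) = 1 and det(q,r) = 0 must be q itself.
  det-determines : ∀ p q r → det p q ≡ + 1 → det p r ≡ + 1 → det q r ≡ 0ℤ → q ≡ r
  det-determines (p₁ , p₂) (q₁ , q₂) (r₁ , r₂) pq pr qr =
    cong₂ _,_ (component (cramer₁ p₁ p₂ q₁ q₂ r₁ r₂)) (component (cramer₂ p₁ p₂ q₁ q₂ r₁ r₂))
    where
    cramer₁ : ∀ p₁ p₂ q₁ q₂ r₁ r₂ →
      (p₁ * q₂ - p₂ * q₁) * r₁ ≡ (p₁ * r₂ - p₂ * r₁) * q₁ - (q₁ * r₂ - q₂ * r₁) * p₁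
    cramer₁ = solve-∀
    cramer₂ : ∀ p₁ p₂ q₁ q₂ r₁ r₂ →
      (p₁ * q₂ - p₂ * q₁) * r₂ ≡ (p₁ * r₂ - p₂ * r₁) * q₂ - (q₁ * r₂ - q₂ * r₁) * p₂
    cramer₂ = solve-∀
    unit-combination : ∀ x y → + 1 * x - 0ℤ * y ≡ x
    unit-combination = solve-∀
    component : ∀ {x y z} → det (p₁ , p₂) (q₁ , q₂) * z ≡
                det (p₁ , p₂) (r₁ , r₂) * y - det (q₁ , q₂) (r₁ , r₂) * x → y ≡ z
    component {x} {y} {z} e = sym (begin
      z                  ≡⟨ sym (ℤP.*-identityˡ z) ⟩
      + 1 * z            ≡⟨ cong (_* z) (sym pq) ⟩
      _                  ≡⟨ e ⟩
      _                  ≡⟨ cong₂ (λ a b → a * y - b * x) pr qr ⟩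
      + 1 * y - 0ℤ * x   ≡⟨ unit-combination y x ⟩
      y                  ∎)
      where open ≡-Reasoning

  difference-of-difference : ∀ x y → x - (x - y) ≡ y
  difference-of-difference = solve-∀

  nonzero-factor : ∀ {x y} → x ≢ 0ℤ → x * y ≡ 0ℤ → y ≡ 0ℤ
  nonzero-factor {x} {y} x≢0 e = ℤP.*-cancelˡ-≡ x y 0ℤ {{≢-nonZero x≢0}} (trans e (sym (ℤP.*-zeroʳ x)))

  Unimodular : (ℕ → ℕ → ℤ) → ℕ → ℕ → Set
  Unimodular f u v = f u (suc v) * f (suc u) v - f u v * f (suc u) (suc v) ≡ + 1

  unimodular-diagonal : ∀ f {u v} → Unimodular f u v →
                        f u v * f (suc u) (suc v) ≡ f u (suc v) * f (suc u) v - + 1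
  unimodular-diagonal f {u} {v} e =
    trans (sym (difference-of-difference (f u (suc v) * f (suc u) v) (f u v * f (suc u) (suc v))))
          (cong (f u (suc v) * f (suc u) v -_) e)

  unimodular-from-ℕ : ∀ a b c d → a ℕ.* b ≡ 1 ℕ.+ c ℕ.* d → + a * + b - + c * + d ≡ + 1
  unimodular-from-ℕ a b c d e = begin
    + a * + b - + c * + d              ≡⟨ cong₂ _-_ (sym (ℤP.pos-* a b)) (sym (ℤP.pos-* c d)) ⟩
    + (a ℕ.* b) - + (c ℕ.* d)          ≡⟨ cong (λ x → + x - + (c ℕ.* d)) e ⟩
    + (1 ℕ.+ c ℕ.* d) - + (c ℕ.* d)    ≡⟨ cong (_- + (c ℕ.* d)) (ℤP.pos-+ 1 (c ℕ.* d)) ⟩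
    + 1 + + (c ℕ.* d) - + (c ℕ.* d)    ≡⟨ cancel (+ (c ℕ.* d)) ⟩
    + 1                                ∎
    where
    open ≡-Reasoning
    cancel : ∀ x → + 1 + x - x ≡ + 1
    cancel = solve-∀

  unimodular-to-ℕ : ∀ a b c d → + a * + b - + c * + d ≡ + 1 → a ℕ.* b ≡ 1 ℕ.+ c ℕ.* d
  unimodular-to-ℕ a b c d e = ℤP.+-injective (begin
    + (a ℕ.* b)                          ≡⟨ ℤP.pos-* a b ⟩
    + a * + b                            ≡⟨ split (+ a * + b) (+ c * + d) ⟩
    (+ a * + b - + c * + d) + + c * + d  ≡⟨ cong₂ _+_ e (sym (ℤP.pos-* c d)) ⟩
    + 1 + + (c ℕ.* d)                    ≡⟨ sym (ℤP.pos-+ 1 (c ℕ.* d)) ⟩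
    + (1 ℕ.+ c ℕ.* d)                    ∎)
    where
    open ≡-Reasoning
    split : ∀ x y → x ≡ (x - y) + y
    split = solve-∀

  -- On the triangle u + v ≤ N an array obeying the diamond rule, with nonzero entries, is
  -- determined by its first row and first column: each cell fixes its lower-right entry.
  unimodular-unique : ∀ N (f g : ℕ → ℕ → ℤ) →
    (∀ u v → 2 ℕ.+ (u ℕ.+ v) ℕ.≤ N → Unimodular f u v) →
    (∀ u v → 2 ℕ.+ (u ℕ.+ v) ℕ.≤ N → Unimodular g u v) →
    (∀ u v → u ℕ.+ v ℕ.≤ N → g u v ≢ 0ℤ) →
    (∀ v → f 0 v ≡ g 0 v) → (∀ u → f u 0 ≡ g u 0) →
    ∀ u v → u ℕ.+ v ℕ.≤ N → f u v ≡ g u v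
  unimodular-unique N f g f-unimodular g-unimodular g-nonzero first-row first-column = agree
    where
    open ≡-Reasoning
    agree : ∀ u v → u ℕ.+ v ℕ.≤ N → f u v ≡ g u v
    agree zero    v       _ = first-row v
    agree (suc u) zero    _ = first-column (suc u)
    agree (suc u) (suc v) h =
      ℤP.*-cancelˡ-≡ (g u v) _ _ {{≢-nonZero (g-nonzero u v corner)}} (begin
        g u v * f (suc u) (suc v)
          ≡⟨ cong (_* f (suc u) (suc v)) (sym (agree u v corner)) ⟩
        f u v * f (suc u) (suc v)
          ≡⟨ unimodular-diagonal f (f-unimodular u v cell) ⟩
        f u (suc v) * f (suc u) v - + 1
          ≡⟨ cong₂ (λ x y → x * y - + 1) (agree u (suc v) right) (agree (suc u) v below) ⟩
        g u (suc v) * g (suc u) v - + 1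
          ≡⟨ sym (unimodular-diagonal g (g-unimodular u v cell)) ⟩
        g u v * g (suc u) (suc v)
          ∎)
      where
      right : u ℕ.+ suc v ℕ.≤ N
      right = ℕP.≤-trans (ℕP.n≤1+n _) h
      cell : 2 ℕ.+ (u ℕ.+ v) ℕ.≤ N
      cell = subst (λ k → suc k ℕ.≤ N) (ℕP.+-suc u v) h
      below : suc u ℕ.+ v ℕ.≤ N
      below = ℕP.≤-trans (ℕP.n≤1+n _) cell
      corner : u ℕ.+ v ℕ.≤ N
      corner = ℕP.≤-trans (ℕP.n≤1+n _) below

open PlaneAlgebra

record UnitTriangle (N : ℕ) : Set where
  field
    T          : ℕ → ℕ → ℕ
    positive   : ∀ u v → u ℕ.+ v ℕ.≤ N → 1 ℕ.≤ T u v
    apex       : T 0 0 ≡ 1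
    hypotenuse : ∀ u v → u ℕ.+ v ≡ N → T u v ≡ 1
    diamond    : ∀ u v → 2 ℕ.+ (u ℕ.+ v) ℕ.≤ N →
                 T u (suc v) ℕ.* T (suc u) v ≡ 1 ℕ.+ T u v ℕ.* T (suc u) (suc v)

-- The seam identity: the edges of a unit triangle satisfy the diamond rule across the
-- hypotenuse once the triangle is reflected, T k 0 · T 0 j = 1 + T (k+1) 0 · T 0 (j+1).
module TriangleSeam {N : ℕ} (τ : UnitTriangle N) where
  open UnitTriangle τ
  open import Data.Integer using (ℤ; +_; 0ℤ; _-_; _*_)
  import Data.Integer.Properties as ℤP
  open import Data.Integer.Tactic.RingSolver using (solve-∀)
  open ≡-Reasoning

  Tℤ : ℕ → ℕ → ℤ
  Tℤ u v = + T u v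

  Tℤ-unimodular : ∀ u v → 2 ℕ.+ (u ℕ.+ v) ℕ.≤ N → Unimodular Tℤ u v
  Tℤ-unimodular u v h =
    unimodular-from-ℕ (T u (suc v)) (T (suc u) v) (T u v) (T (suc u) (suc v)) (diamond u v h)

  Tℤ-nonzero : ∀ u v → u ℕ.+ v ℕ.≤ N → Tℤ u v ≢ 0ℤ
  Tℤ-nonzero u v h e = ℕP.m<n⇒n≢0 (positive u v h) (ℤP.+-injective e)

  apexℤ : Tℤ 0 0 ≡ + 1
  apexℤ = cong +_ apex

  -- Row vectors α u and column vectors γ v, built from the first two rows and columns, such
  -- that C u v = det (α u , γ v) agrees with T on the triangle (see representation).
  α : ℕ → V2
  α u = Tℤ u 0 , Tℤ u 0 * Tℤ 0 1 - Tℤ u 1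

  γ : ℕ → V2
  γ v = Tℤ 1 0 * Tℤ 0 v - Tℤ 1 v , Tℤ 0 v

  C : ℕ → ℕ → ℤ
  C u v = det (α u) (γ v)

  -- Consecutive vectors form unimodular bases; each is a diamond of T along an edge.
  α-step : ∀ u → 2 ℕ.+ u ℕ.≤ N → det (α u) (α (suc u)) ≡ + 1
  α-step u h = trans (expanded (Tℤ u 0) (Tℤ u 1) (Tℤ (suc u) 0) (Tℤ (suc u) 1) (Tℤ 0 1))
                     (Tℤ-unimodular u 0 (subst (λ k → 2 ℕ.+ k ℕ.≤ N) (sym (ℕP.+-identityʳ u)) h))
    where
    expanded : ∀ x z x′ z′ y → x * (x′ * y - z′) - (x * y - z) * x′ ≡ z * x′ - x * z′
    expanded = solve-∀

  γ-step : ∀ v → 2 ℕ.+ v ℕ.≤ N → det (γ (suc v)) (γ v) ≡ + 1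
  γ-step v h = trans (expanded (Tℤ 1 0) (Tℤ 0 v) (Tℤ 1 v) (Tℤ 0 (suc v)) (Tℤ 1 (suc v)))
                     (Tℤ-unimodular 0 v h)
    where
    expanded : ∀ x y z y′ z′ → (x * y′ - z′) * y - y′ * (x * y - z) ≡ y′ * z - y * z′
    expanded = solve-∀

  -- By the Plücker relation C obeys the diamond rule wherever both steps are available,
  -- including cells that stick out beyond the hypotenuse.
  C-unimodular : ∀ u v → 2 ℕ.+ u ℕ.≤ N → 2 ℕ.+ v ℕ.≤ N → Unimodular C u v
  C-unimodular u v hu hv = trans (plücker (α u) (α (suc u)) (γ (suc v)) (γ v))
                                 (cong₂ _*_ (α-step u hu) (γ-step v hv))

  C-first-row : ∀ v → C 0 v ≡ Tℤ 0 v
  C-first-row v = trans (cong (λ e → e * Tℤ 0 v - (e * Tℤ 0 1 - Tℤ 0 1) * proj₁ (γ v)) apexℤ)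
                        (expanded (Tℤ 0 v) (Tℤ 0 1) (proj₁ (γ v)))
    where
    expanded : ∀ y w c → + 1 * y - (+ 1 * w - w) * c ≡ y
    expanded = solve-∀

  C-first-column : ∀ u → C u 0 ≡ Tℤ u 0
  C-first-column u = trans (cong (λ e → Tℤ u 0 * e - proj₂ (α u) * (Tℤ 1 0 * e - Tℤ 1 0)) apexℤ)
                           (expanded (Tℤ u 0) (proj₂ (α u)) (Tℤ 1 0))
    where
    expanded : ∀ x c w → x * + 1 - c * (w * + 1 - w) ≡ x
    expanded = solve-∀

  representation : ∀ u v → u ℕ.+ v ℕ.≤ N → C u v ≡ Tℤ u v
  representation = unimodular-unique N C Tℤ
    (λ u v h → C-unimodular u v (ℕP.≤-trans (ℕP.+-monoʳ-≤ 2 (ℕP.m≤m+n u v)) h)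
                                (ℕP.≤-trans (ℕP.+-monoʳ-≤ 2 (ℕP.m≤n+m v u)) h))
    Tℤ-unimodular Tℤ-nonzero C-first-row C-first-column

  C-hypotenuse : ∀ u v → u ℕ.+ v ≡ N → C u v ≡ + 1
  C-hypotenuse u v e = trans (representation u v (ℕP.≤-reflexive e)) (cong +_ (hypotenuse u v e))

  leg-bound : ∀ {k j} → suc (k ℕ.+ j) ≡ N → 1 ℕ.≤ k → 2 ℕ.+ j ℕ.≤ N
  leg-bound {k} {j} e hk = subst (2 ℕ.+ j ℕ.≤_) e (s≤s (ℕP.+-monoˡ-≤ j hk))

  leg-bound′ : ∀ {k j} → suc (k ℕ.+ j) ≡ N → 1 ℕ.≤ j → 2 ℕ.+ k ℕ.≤ N
  leg-bound′ {k} {j} e = leg-bound (trans (cong suc (ℕP.+-comm j k)) e)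

  -- Just beyond the hypotenuse C vanishes: the diamond rule with three corners on or inside
  -- the hypotenuse reads 1 · 1 - T k j · C (k+1) (j+1) = 1.
  C-beyond : ∀ k j → suc (k ℕ.+ j) ≡ N → 1 ℕ.≤ k → 1 ℕ.≤ j → C (suc k) (suc j) ≡ 0ℤ
  C-beyond k j e hk hj = nonzero-factor (Tℤ-nonzero k j inside) (begin
    Tℤ k j * C (suc k) (suc j)
      ≡⟨ cong (_* C (suc k) (suc j)) (sym (representation k j inside)) ⟩
    C k j * C (suc k) (suc j)
      ≡⟨ unimodular-diagonal C (C-unimodular k j (leg-bound′ e hj) (leg-bound e hk)) ⟩
    C k (suc j) * C (suc k) j - + 1
      ≡⟨ cong₂ (λ x y → x * y - + 1) (C-hypotenuse k (suc j) (trans (ℕP.+-suc k j) e)) (C-hypotenuse (suc k) j e) ⟩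
    + 1 * + 1 - + 1
      ≡⟨⟩
    0ℤ
      ∎)
    where
    inside : k ℕ.+ j ℕ.≤ N
    inside = ℕP.≤-trans (ℕP.n≤1+n _) (ℕP.≤-reflexive e)

  seam : ∀ k j → suc (k ℕ.+ j) ≡ N → 1 ℕ.≤ k → 1 ℕ.≤ j → α (suc k) ≡ γ (suc j)
  seam k j e hk hj = det-determines (α k) (α (suc k)) (γ (suc j)) (α-step k (leg-bound′ e hj))
                                    (C-hypotenuse k (suc j) (trans (ℕP.+-suc k j) e))
                                    (C-beyond k j e hk hj)

  first-row-seam : ∀ k j → k ℕ.+ j ≡ N → 1 ℕ.≤ k → 1 ℕ.≤ j → det (α 0) (α k) ≡ C 0 (suc j)
  first-row-seam (suc zero)    j e _ hj =
    trans (α-step 0 (subst (2 ℕ.≤_) e (s≤s hj))) (sym (C-hypotenuse 0 (suc j) e))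
  first-row-seam (suc (suc k)) j e _ hj = cong (det (α 0)) (seam (suc k) j e (s≤s z≤n) hj)

  first-column-seam : ∀ k j → k ℕ.+ j ≡ N → 1 ℕ.≤ k → 1 ℕ.≤ j → det (γ j) (γ 0) ≡ C (suc k) 0
  first-column-seam k (suc zero)    e hk _ =
    trans (γ-step 0 (subst (2 ℕ.≤_) e (ℕP.+-monoˡ-≤ 1 hk)))
          (sym (C-hypotenuse (suc k) 0 (trans (sym (ℕP.+-suc k 0)) e)))
  first-column-seam k (suc (suc j)) e hk _ =
    cong (λ w → det w (γ 0)) (sym (seam k (suc j) (trans (sym (ℕP.+-suc k (suc j))) e) hk (s≤s z≤n)))

  -- The Plücker relation for α k, α 0, γ 0, γ j turns the seam into the identity.
  seam-identity : ∀ k j → 1 ℕ.≤ k → 1 ℕ.≤ j → k ℕ.+ j ≡ N →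
                  T k 0 ℕ.* T 0 j ≡ 1 ℕ.+ T (suc k) 0 ℕ.* T 0 (suc j)
  seam-identity k j hk hj e = unimodular-to-ℕ (T k 0) (T 0 j) (T (suc k) 0) (T 0 (suc j)) (begin
    Tℤ k 0 * Tℤ 0 j - Tℤ (suc k) 0 * Tℤ 0 (suc j)
      ≡⟨ cong₂ _-_ (sym (cong₂ _*_ (representation k 0 k-edge) (representation 0 j j-edge))) outer-entries ⟩
    C k 0 * C 0 j - det (α 0) (α k) * det (γ j) (γ 0)
      ≡⟨ cong (C k 0 * C 0 j -_) (sym (trans (plücker (α k) (α 0) (γ 0) (γ j))
                                             (det-swap-both (α k) (α 0) (γ 0) (γ j)))) ⟩
    C k 0 * C 0 j - (C k 0 * C 0 j - C k j * C 0 0)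
      ≡⟨ difference-of-difference (C k 0 * C 0 j) (C k j * C 0 0) ⟩
    C k j * C 0 0
      ≡⟨ cong₂ _*_ (C-hypotenuse k j e) (trans (representation 0 0 z≤n) apexℤ) ⟩
    + 1 ∎)
    where
    k-edge : k ℕ.+ 0 ℕ.≤ N
    k-edge = subst (ℕ._≤ N) (sym (ℕP.+-identityʳ k)) (ℕP.≤-trans (ℕP.m≤m+n k j) (ℕP.≤-reflexive e))
    j-edge : j ℕ.≤ N
    j-edge = ℕP.≤-trans (ℕP.m≤n+m j k) (ℕP.≤-reflexive e)
    k+1-edge : suc k ℕ.+ 0 ℕ.≤ N
    k+1-edge = subst (ℕ._≤ N) (trans (ℕP.+-comm k 1) (cong suc (sym (ℕP.+-identityʳ k))))
                     (ℕP.≤-trans (ℕP.+-monoʳ-≤ k hj) (ℕP.≤-reflexive e))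
    j+1-edge : suc j ℕ.≤ N
    j+1-edge = ℕP.≤-trans (ℕP.+-monoˡ-≤ j hk) (ℕP.≤-reflexive e)
    outer-entries : Tℤ (suc k) 0 * Tℤ 0 (suc j) ≡ det (α 0) (α k) * det (γ j) (γ 0)
    outer-entries = begin
      Tℤ (suc k) 0 * Tℤ 0 (suc j)
        ≡⟨ sym (cong₂ _*_ (representation (suc k) 0 k+1-edge) (representation 0 (suc j) j+1-edge)) ⟩
      C (suc k) 0 * C 0 (suc j)
        ≡⟨ ℤP.*-comm (C (suc k) 0) (C 0 (suc j)) ⟩
      C 0 (suc j) * C (suc k) 0
        ≡⟨ sym (cong₂ _*_ (first-row-seam k j e hk hj) (first-column-seam k j e hk hj)) ⟩
      det (α 0) (α k) * det (γ j) (γ 0) ∎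

-- Positions modulo K + 1, represented by 0..K: the cyclic successor, and the residue ρ of an
-- integer, which advances by the cyclic successor when the integer increases by one.
module Cyclic (K : ℕ) where
  open import Data.Nat using (_≤_; _<_; _≟_)
  open import Data.Nat.Properties using (<-irrefl; ≤∧≢⇒<; ≤-refl; <⇒≤; +-comm)
  open import Data.Integer as ℤ using (ℤ; -[1+_])
  open import Data.Empty using (⊥-elim)
  open import Relation.Nullary using (yes; no)

  next : ℕ → ℕ
  next r with r ≟ K
  ... | yes _ = 0
  ... | no  _ = suc r

  next-below : ∀ {r} → r < K → next r ≡ suc r
  next-below {r} r<K with r ≟ K
  ... | yes refl = ⊥-elim (<-irrefl refl r<K)
  ... | no  _    = refl

  next-top : next K ≡ 0
  next-top with K ≟ K
  ... | yes _   = refl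
  ... | no  K≢K = ⊥-elim (K≢K refl)

  next-bound : ∀ {r} → r ≤ K → next r ≤ K
  next-bound {r} r≤K with r ≟ K
  ... | yes _   = z≤n
  ... | no  r≢K = ≤∧≢⇒< r≤K r≢K

  prev : ℕ → ℕ
  prev zero    = K
  prev (suc r) = r

  prev-bound : ∀ {r} → r ≤ K → prev r ≤ K
  prev-bound {zero}  _   = ≤-refl
  prev-bound {suc r} r<K = <⇒≤ r<K

  next-prev : ∀ {r} → r ≤ K → next (prev r) ≡ r
  next-prev {zero}  _   = next-top
  next-prev {suc r} r<K = next-below r<K

  forward : ℕ → ℕ
  forward zero    = 0
  forward (suc k) = next (forward k)

  backward : ℕ → ℕ
  backward zero    = K
  backward (suc k) = prev (backward k)

  ρ : ℤ → ℕ
  ρ (ℤ.+ k)  = forward k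
  ρ -[1+ k ] = backward k

  ρ-bound : ∀ z → ρ z ≤ K
  ρ-bound (ℤ.+ k)  = forward-bound k
    where
    forward-bound : ∀ k → forward k ≤ K
    forward-bound zero    = z≤n
    forward-bound (suc k) = next-bound (forward-bound k)
  ρ-bound -[1+ k ] = backward-bound k
    where
    backward-bound : ∀ k → backward k ≤ K
    backward-bound zero    = ≤-refl
    backward-bound (suc k) = prev-bound (backward-bound k)

  ρ-suc : ∀ z → ρ (z ℤ.+ ℤ.+ 1) ≡ next (ρ z)
  ρ-suc (ℤ.+ k)        = cong forward (+-comm k 1)
  ρ-suc -[1+ zero ]    = sym next-top
  ρ-suc -[1+ suc k ]   = sym (next-prev (ρ-bound -[1+ k ]))

  ρ-identity : ∀ {u} → u ≤ K → ρ (ℤ.+ u) ≡ u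
  ρ-identity {zero}  _   = refl
  ρ-identity {suc u} u<K = trans (cong next (ρ-identity (<⇒≤ u<K))) (next-below u<K)

-- A friese of width N in cyclic coordinates: S d r is the entry in row d (0 ≤ d ≤ N) at
-- position r modulo N + 2; the outer rows are 1 and each diamond has determinant 1.
module _ (N : ℕ) where
  open import Data.Nat using (_+_; _*_; _≤_)
  open Cyclic (suc N) using (next)

  record CyclicFriese : Set where
    field
      S          : ℕ → ℕ → ℕ
      positive   : ∀ d r → d ≤ N → r ≤ suc N → 1 ≤ S d r
      top        : ∀ r → r ≤ suc N → S 0 r ≡ 1
      bottom     : ∀ r → r ≤ suc N → S N r ≡ 1
      unimodular : ∀ d r → 2 + d ≤ N → r ≤ suc N →
                   S (suc d) r * S (suc d) (next r) ≡ 1 + S d r * S (suc (suc d)) (next r)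

module GlideExtension {N : ℕ} (τ : UnitTriangle N) where
  open import Data.Nat using (_+_; _*_; _∸_; _≤_; s≤s⁻¹; _≤?_)
  open import Data.Nat.Properties
  open import Data.Sum using (_⊎_; inj₁; inj₂)
  open import Data.Empty using (⊥-elim)
  open import Function using (_∘_)
  open import Relation.Nullary using (yes; no)
  open UnitTriangle τ
  open TriangleSeam τ using (seam-identity)
  open Cyclic (suc N) using (next; next-below; next-top)

  S : ℕ → ℕ → ℕ
  S d r with r ≤? d
  ... | yes _ = T r (d ∸ r)
  ... | no  _ = T (r ∸ suc d) (suc N ∸ r)

  S-direct : ∀ {d} r v → r + v ≡ d → S d r ≡ T r v
  S-direct r v refl with r ≤? r + v
  ... | yes _   = cong (T r) (m+n∸m≡n r v)
  ... | no  r≰d = ⊥-elim (r≰d (m≤m+n r v))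

  S-reflected : ∀ d {r} p q → suc (p + d) ≡ r → p + d + q ≡ N → S d r ≡ T p q
  S-reflected d p q refl e with suc (p + d) ≤? d
  ... | yes r≤d = ⊥-elim (m+n≮n p d r≤d)
  ... | no  _   = cong₂ T (m+n∸n≡m p d) (trans (cong (_∸ (p + d)) (sym e)) (m+n∸m≡n (p + d) q))

  data Position (d r : ℕ) : Set where
    direct    : ∀ v → r + v ≡ d → Position d r
    reflected : ∀ p q → suc (p + d) ≡ r → p + d + q ≡ N → Position d r

  position : ∀ d r → r ≤ suc N → Position d r
  position d r r≤ with r ≤? d
  ... | yes r≤d = direct (d ∸ r) (m+[n∸m]≡n r≤d)
  ... | no  r≰d = reflected p q shift (suc-injective (trans (cong (_+ q) shift) (m+[n∸m]≡n r≤)))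
    where
    p = r ∸ suc d
    q = suc N ∸ r
    shift : suc (p + d) ≡ r
    shift = trans (cong suc (+-comm p d)) (m+[n∸m]≡n (≰⇒> r≰d))

  entry : ∀ d r → r ≤ suc N → ∃[ u ] ∃[ v ] S d r ≡ T u v × (u + v ≡ d ⊎ u + v + d ≡ N)
  entry d r r≤ with position d r r≤
  ... | direct v e         = r , v , S-direct r v e , inj₁ e
  ... | reflected p q e e′ = p , q , S-reflected d p q e e′ , inj₂ (trans (swap-last p q d) e′)
    where
    swap-last : ∀ a b c → a + b + c ≡ a + c + b
    swap-last a b c = trans (+-assoc a b c) (trans (cong (_+_ a) (+-comm b c)) (sym (+-assoc a c b)))

  unit-entry : ∀ u v → u + v ≡ 0 ⊎ u + v ≡ N → T u v ≡ 1
  unit-entry zero    zero    (inj₁ _) = apex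
  unit-entry zero    (suc v) (inj₁ ())
  unit-entry (suc u) v       (inj₁ ())
  unit-entry u       v       (inj₂ e) = hypotenuse u v e

  S-positive : ∀ d r → d ≤ N → r ≤ suc N → 1 ≤ S d r
  S-positive d r d≤N r≤ with entry d r r≤
  ... | u , v , S≡T , sum = subst (1 ≤_) (sym S≡T) (positive u v (leg-sum sum))
    where
    leg-sum : u + v ≡ d ⊎ u + v + d ≡ N → u + v ≤ N
    leg-sum (inj₁ e) = subst (_≤ N) (sym e) d≤N
    leg-sum (inj₂ e) = ≤-trans (m≤m+n (u + v) d) (≤-reflexive e)

  S-top : ∀ r → r ≤ suc N → S 0 r ≡ 1
  S-top r r≤ with entry 0 r r≤
  ... | u , v , S≡T , inj₁ e = trans S≡T (unit-entry u v (inj₁ e))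
  ... | u , v , S≡T , inj₂ e = trans S≡T (unit-entry u v (inj₂ (trans (sym (+-identityʳ (u + v))) e)))

  S-bottom : ∀ r → r ≤ suc N → S N r ≡ 1
  S-bottom r r≤ with entry N r r≤
  ... | u , v , S≡T , inj₁ e = trans S≡T (unit-entry u v (inj₂ e))
  ... | u , v , S≡T , inj₂ e = trans S≡T (unit-entry u v (inj₁ (+-cancelʳ-≡ N (u + v) 0 e)))

  -- The diamond rule in the four kinds of position: inside the triangle, across the seam
  -- r = d + 1, across the wrap-around from r = N + 1 to 0, and inside the reflection.
  unimodular-direct : ∀ r v → 2 + (r + v) ≤ N →
    S (suc (r + v)) r * S (suc (r + v)) (suc r) ≡ 1 + S (r + v) r * S (suc (suc (r + v))) (suc r)
  unimodular-direct r v h = begin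
    S (suc (r + v)) r * S (suc (r + v)) (suc r)
      ≡⟨ cong₂ _*_ (S-direct r (suc v) (+-suc r v)) (S-direct (suc r) v refl) ⟩
    T r (suc v) * T (suc r) v
      ≡⟨ diamond r v h ⟩
    1 + T r v * T (suc r) (suc v)
      ≡⟨ cong (1 +_) (sym (cong₂ _*_ (S-direct r v refl) (S-direct (suc r) (suc v) (cong suc (+-suc r v))))) ⟩
    1 + S (r + v) r * S (suc (suc (r + v))) (suc r)
      ∎
    where open ≡-Reasoning

  unimodular-seam : ∀ d q → 2 + d ≤ N → d + q ≡ N →
    S (suc d) (suc d) * S (suc d) (suc (suc d)) ≡ 1 + S d (suc d) * S (suc (suc d)) (suc (suc d))
  unimodular-seam d q h e with +-cancelʳ-≤ d 2 q (subst (2 + d ≤_) (sym (trans (+-comm q d) e)) h)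
  ... | s≤s (s≤s {n = q′} _) = begin
    S (suc d) (suc d) * S (suc d) (suc (suc d))
      ≡⟨ cong₂ _*_ (S-direct (suc d) 0 (+-identityʳ (suc d))) (S-reflected (suc d) 0 (suc q′) refl e′) ⟩
    T (suc d) 0 * T 0 (suc q′)
      ≡⟨ seam-identity (suc d) (suc q′) (s≤s z≤n) (s≤s z≤n) e′ ⟩
    1 + T (suc (suc d)) 0 * T 0 (suc (suc q′))
      ≡⟨ cong (1 +_) (*-comm (T (suc (suc d)) 0) (T 0 (suc (suc q′)))) ⟩
    1 + T 0 (suc (suc q′)) * T (suc (suc d)) 0
      ≡⟨ cong (1 +_) (sym (cong₂ _*_ (S-reflected d 0 (suc (suc q′)) refl e)
                                     (S-direct (suc (suc d)) 0 (+-identityʳ (suc (suc d)))))) ⟩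
    1 + S d (suc d) * S (suc (suc d)) (suc (suc d))
      ∎
    where
    open ≡-Reasoning
    e′ : suc d + suc q′ ≡ N
    e′ = trans (sym (+-suc d (suc q′))) e

  unimodular-wrap : ∀ d p → 2 + d ≤ N → suc (p + d) + 0 ≡ N →
    S (suc d) (suc (suc (p + d))) * S (suc d) 0 ≡ 1 + S d (suc (suc (p + d))) * S (suc (suc d)) 0
  unimodular-wrap d p h e with +-cancelʳ-≤ d 1 p (s≤s⁻¹ (subst (2 + d ≤_) (sym (trans (sym (+-identityʳ _)) e)) h))
  ... | s≤s {n = p′} _ = begin
    S (suc d) (suc (suc (suc p′ + d))) * S (suc d) 0
      ≡⟨ cong₂ _*_ (S-reflected (suc d) (suc p′) 0 (cong (suc ∘ suc) (+-suc p′ d)) e′) (S-direct 0 (suc d) refl) ⟩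
    T (suc p′) 0 * T 0 (suc d)
      ≡⟨ seam-identity (suc p′) (suc d) (s≤s z≤n) (s≤s z≤n) (trans (sym (+-identityʳ _)) e′) ⟩
    1 + T (suc (suc p′)) 0 * T 0 (suc (suc d))
      ≡⟨ cong (1 +_) (sym (cong₂ _*_ (S-reflected d (suc (suc p′)) 0 refl e) (S-direct 0 (suc (suc d)) refl))) ⟩
    1 + S d (suc (suc (suc p′ + d))) * S (suc (suc d)) 0
      ∎
    where
    open ≡-Reasoning
    e′ : suc p′ + suc d + 0 ≡ N
    e′ = trans (cong (λ x → suc x + 0) (+-suc p′ d)) e

  unimodular-reflected : ∀ d p q → suc (p + d) + suc q ≡ N →
    S (suc d) (suc (suc (p + d))) * S (suc d) (suc (suc (suc (p + d))))
      ≡ 1 + S d (suc (suc (p + d))) * S (suc (suc d)) (suc (suc (suc (p + d))))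
  unimodular-reflected d p q e = begin
    S (suc d) (suc (suc (p + d))) * S (suc d) (suc (suc (suc (p + d))))
      ≡⟨ cong₂ _*_ (S-reflected (suc d) p (suc q) (cong suc one-step) (trans (cong (_+ suc q) one-step) e))
                   (S-reflected (suc d) (suc p) q (cong (suc ∘ suc) one-step) (trans (cong (λ x → suc x + q) one-step) e₂)) ⟩
    T p (suc q) * T (suc p) q
      ≡⟨ diamond p q (subst (2 + (p + q) ≤_) e₂ (s≤s (s≤s (+-monoˡ-≤ q (m≤m+n p d))))) ⟩
    1 + T p q * T (suc p) (suc q)
      ≡⟨ cong (1 +_) (*-comm (T p q) (T (suc p) (suc q))) ⟩
    1 + T (suc p) (suc q) * T p q
      ≡⟨ cong (1 +_) (sym (cong₂ _*_ (S-reflected d (suc p) (suc q) refl e)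
                                     (S-reflected (suc (suc d)) p q (cong suc two-steps) (trans (cong (_+ q) two-steps) e₂)))) ⟩
    1 + S d (suc (suc (p + d))) * S (suc (suc d)) (suc (suc (suc (p + d))))
      ∎
    where
    open ≡-Reasoning
    e₂ : suc (suc (p + d + q)) ≡ N
    e₂ = trans (cong suc (sym (+-suc (p + d) q))) e
    one-step : p + suc d ≡ suc (p + d)
    one-step = +-suc p d
    two-steps : p + suc (suc d) ≡ suc (suc (p + d))
    two-steps = trans (+-suc p (suc d)) (cong suc one-step)

  S-unimodular : ∀ d r → 2 + d ≤ N → r ≤ suc N →
    S (suc d) r * S (suc d) (next r) ≡ 1 + S d r * S (suc (suc d)) (next r)
  S-unimodular d r h r≤ with position d r r≤
  ... | direct v refl
    rewrite next-below (s≤s (≤-trans (m≤m+n r v) (≤-trans (m≤n+m (r + v) 2) h)))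
    = unimodular-direct r v h
  ... | reflected zero q refl e
    rewrite next-below (≤-trans h (n≤1+n N))
    = unimodular-seam d q h e
  ... | reflected (suc p) zero refl e
    rewrite trans (cong (next ∘ suc) (trans (sym (+-identityʳ _)) e)) next-top
    = unimodular-wrap d p h e
  ... | reflected (suc p) (suc q) refl e
    rewrite next-below (s≤s (subst (suc (suc (p + d)) ≤_) e (s≤s (≤-trans (s≤s (m≤m+n (p + d) q))
                                                                             (≤-reflexive (sym (+-suc (p + d) q)))))))
    = unimodular-reflected d p q e

  friese : CyclicFriese N
  friese = record
    { S = S ; positive = S-positive ; top = S-top ; bottom = S-bottom ; unimodular = S-unimodular }

-- A cyclic friese read along the band m ≤ x - y ≤ m + N: the point (x , y) lies in row
-- δ x y = x - y - m, at the position ρ (x - a) modulo N + 2 (the anchor a is arbitrary).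
module BandFriese {N : ℕ} (P : CyclicFriese N) (m a : ℤ) where
  open import Data.Integer using (ℤ; +_; _+_; _-_; -_; _≤_; ∣_∣)
  import Data.Integer.Properties as ℤP
  open import Data.Integer.Tactic.RingSolver using (solve-∀)
  open CyclicFriese P
  open Cyclic (suc N) using (next; ρ; ρ-bound; ρ-suc)

  δ : ℤ → ℤ → ℤ
  δ x y = (x - y) - m

  s : ℤ → ℤ → ℕ
  s x y = S ∣ δ x y ∣ (ρ (x - a))

  s-value : ∀ x y {d r} → δ x y ≡ + d → ρ (x - a) ≡ r → s x y ≡ S d r
  s-value x y e e′ = cong₂ (λ w r → S ∣ w ∣ r) e e′

  shifted-width : ∀ m n → (m + n) - m ≡ n
  shifted-width = solve-∀

  band-row : ∀ x y → Band m (m + + N) x y → Σ[ d ∈ ℕ ] (δ x y ≡ + d × d ℕ.≤ N)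
  band-row x y (m≤ , ≤M) =
    ∣ δ x y ∣ , sym nonnegative , ℤP.drop‿+≤+ (subst (_≤ + N) (sym nonnegative) below-width)
    where
    nonnegative : + ∣ δ x y ∣ ≡ δ x y
    nonnegative = ℤP.0≤i⇒+∣i∣≡i (ℤP.i≤j⇒0≤j-i m≤)
    below-width : δ x y ≤ + N
    below-width = subst (δ x y ≤_) (shifted-width m (+ N)) (ℤP.+-monoˡ-≤ (- m) ≤M)

  row-bound : ∀ x y {d} → Band m (m + + N) x y → δ x y ≡ + d → d ℕ.≤ N
  row-bound x y b e with band-row x y b
  ... | d , e′ , d≤N = subst (ℕ._≤ N) (ℤP.+-injective (trans (sym e′) e)) d≤N

  s-positive : ∀ x y → Band m (m + + N) x y → s x y ℕ.≥ 1
  s-positive x y b with band-row x y b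
  ... | d , e , d≤N = subst (1 ℕ.≤_) (sym (s-value x y e refl)) (positive d (ρ (x - a)) d≤N (ρ-bound (x - a)))

  -- Around a diamond with upper-left corner (i , j) the rows are d+1, d, d+2, d+1 and the
  -- positions r, r, next r, next r, where d is the row of (i , j+1): the rule of the pattern.
  s-unimodular : ∀ i j → Band m (m + + N) i j → Band m (m + + N) i (j + + 1) →
    Band m (m + + N) (i + + 1) j → Band m (m + + N) (i + + 1) (j + + 1) →
    s i j ℕ.* s (i + + 1) (j + + 1) ≡ 1 ℕ.+ s i (j + + 1) ℕ.* s (i + + 1) j
  s-unimodular i j _ b₀₁ b₁₀ _ with band-row i (j + + 1) b₀₁
  ... | d , e₀₁ , _ = begin
    s i j ℕ.* s (i + + 1) (j + + 1)
      ≡⟨ cong₂ ℕ._*_ (s-value i j e₀₀ refl) (s-value (i + + 1) (j + + 1) e₁₁ ρ-step) ⟩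
    S (suc d) r ℕ.* S (suc d) (next r)
      ≡⟨ unimodular d r (row-bound (i + + 1) j b₁₀ e₁₀) (ρ-bound (i - a)) ⟩
    1 ℕ.+ S d r ℕ.* S (suc (suc d)) (next r)
      ≡⟨ sym (cong (1 ℕ.+_) (cong₂ ℕ._*_ (s-value i (j + + 1) e₀₁ refl) (s-value (i + + 1) j e₁₀ ρ-step))) ⟩
    1 ℕ.+ s i (j + + 1) ℕ.* s (i + + 1) j
      ∎
    where
    open ≡-Reasoning
    r = ρ (i - a)
    left : ∀ x y m → (x - y) - m ≡ + 1 + ((x - (y + + 1)) - m)
    left = solve-∀
    down : ∀ x y m → ((x + + 1) - y) - m ≡ + 1 + ((x - y) - m)
    down = solve-∀
    diagonal : ∀ x y m → ((x + + 1) - (y + + 1)) - m ≡ (x - y) - m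
    diagonal = solve-∀
    shift : ∀ x a → (x + + 1) - a ≡ (x - a) + + 1
    shift = solve-∀
    e₀₀ : δ i j ≡ + suc d
    e₀₀ = trans (left i j m) (cong (_+_ (+ 1)) e₀₁)
    e₁₁ : δ (i + + 1) (j + + 1) ≡ + suc d
    e₁₁ = trans (diagonal i j m) e₀₀
    e₁₀ : δ (i + + 1) j ≡ + suc (suc d)
    e₁₀ = trans (down i j m) (cong (_+_ (+ 1)) e₀₀)
    ρ-step : ρ ((i + + 1) - a) ≡ next r
    ρ-step = trans (cong ρ (shift i a)) (ρ-suc (i - a))

  s-top : ∀ x y → x - y ≡ m → s x y ≡ 1
  s-top x y e = trans (s-value x y (trans (cong (_- m) e) (ℤP.+-inverseʳ m)) refl)
                      (top (ρ (x - a)) (ρ-bound (x - a)))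

  s-bottom : ∀ x y → x - y ≡ m + + N → s x y ≡ 1
  s-bottom x y e = trans (s-value x y (trans (cong (_- m) e) (shifted-width m (+ N))) refl)
                         (bottom (ρ (x - a)) (ρ-bound (x - a)))

  s-friese : IsFriese m (m + + N) s
  s-friese = (s-positive , s-unimodular) , s-top , s-bottom

-- The corner triangle of the band with apex (a , b): its points are (a + u , b - v) with
-- u + v ≤ N, and a partial tiling on it with unit boundary is a unit triangle.
module Corner (a b : ℤ) (N : ℕ) (t : ℤ → ℤ → ℕ) where
  open import Data.Integer using (ℤ; +_; _+_; _-_; _≤_; ∣_∣; +≤+)
  import Data.Integer.Properties as ℤP
  open import Data.Integer.Tactic.RingSolver using (solve-∀)

  InCorner : ℤ → ℤ → Set
  InCorner x y = Band (a - b) ((a - b) + + N) x y × (a ≤ x × y ≤ b)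

  offset : ∀ u v → (a + + u) - (b - + v) ≡ (a - b) + + (u ℕ.+ v)
  offset u v = expanded a b (+ u) (+ v)
    where
    expanded : ∀ a b u v → (a + u) - (b - v) ≡ (a - b) + (u + v)
    expanded = solve-∀

  in-corner : ∀ u v → u ℕ.+ v ℕ.≤ N → InCorner (a + + u) (b - + v)
  in-corner u v h = (subst ((a - b) ≤_) (sym (offset u v)) (ℤP.i≤i+j (a - b) (+ (u ℕ.+ v))) ,
                     subst (_≤ (a - b) + + N) (sym (offset u v)) (ℤP.+-monoʳ-≤ (a - b) (+≤+ h))) ,
                    ℤP.i≤i+j a (+ u) , ℤP.i-j≤i b (+ v)

  triangle : IsPartialSL2Tiling InCorner t → t a b ≡ 1 →
             (∀ x y → InCorner x y → x - y ≡ (a - b) + + N → t x y ≡ 1) → UnitTriangle N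
  triangle (positiveᶜ , unimodularᶜ) apexᶜ hypotenuseᶜ = record
    { T          = T
    ; positive   = λ u v h → positiveᶜ _ _ (in-corner u v h)
    ; apex       = trans (cong₂ t (ℤP.+-identityʳ a) (ℤP.+-identityʳ b)) apexᶜ
    ; hypotenuse = λ u v e → hypotenuseᶜ _ _ (in-corner u v (ℕP.≤-reflexive e))
                                              (trans (offset u v) (cong (λ k → (a - b) + + k) e))
    ; diamond    = diamond
    }
    where
    T : ℕ → ℕ → ℕ
    T u v = t (a + + u) (b - + v)
    -- The tiling rule at (a + u , b - (v+1)), with the neighbouring lattice points renamed.
    diamond : ∀ u v → 2 ℕ.+ (u ℕ.+ v) ℕ.≤ N →
              T u (suc v) ℕ.* T (suc u) v ≡ 1 ℕ.+ T u v ℕ.* T (suc u) (suc v)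
    diamond u v h = subst₂ (λ x y → t i j ℕ.* t x y ≡ 1 ℕ.+ t i y ℕ.* t x j) right up
      (unimodularᶜ i j (in-corner u (suc v) (ℕP.≤-trans (ℕP.n≤1+n _) h₁₁))
                       (subst (InCorner i) (sym up) (in-corner u v (ℕP.≤-trans (ℕP.n≤1+n _) h₁₀)))
                       (subst (λ x → InCorner x j) (sym right) (in-corner (suc u) (suc v) h₁₁))
                       (subst₂ InCorner (sym right) (sym up) (in-corner (suc u) v h₁₀)))
      where
      i = a + + u
      j = b - + suc v
      right : i + + 1 ≡ a + + suc u
      right = expanded a (+ u)
        where
        expanded : ∀ a u → (a + u) + + 1 ≡ a + (+ 1 + u)
        expanded = solve-∀
      up : j + + 1 ≡ b - + v
      up = expanded b (+ v)
        where
        expanded : ∀ b v → (b - (+ 1 + v)) + + 1 ≡ b - v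
        expanded = solve-∀
      h₁₁ : suc u ℕ.+ suc v ℕ.≤ N
      h₁₁ = subst (λ k → suc k ℕ.≤ N) (sym (ℕP.+-suc u v)) h
      h₁₀ : suc u ℕ.+ v ℕ.≤ N
      h₁₀ = ℕP.≤-trans (ℕP.n≤1+n _) h

  corner-coordinates : ∀ {x y} → a ≤ x → y ≤ b →
    (x - a ≡ + ∣ x - a ∣) × ((x - y) - (a - b) ≡ + (∣ x - a ∣ ℕ.+ ∣ b - y ∣)) ×
    (t x y ≡ t (a + + ∣ x - a ∣) (b - + ∣ b - y ∣))
  corner-coordinates {x} {y} a≤x y≤b =
    sym eu ,
    trans (split x y a b) (cong₂ _+_ (sym eu) (sym ev)) ,
    cong₂ t (trans (sym (add-back a x)) (cong (_+_ a) (sym eu)))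
            (trans (sym (subtract-back b y)) (cong (_-_ b) (sym ev)))
    where
    eu : + ∣ x - a ∣ ≡ x - a
    eu = ℤP.0≤i⇒+∣i∣≡i (ℤP.i≤j⇒0≤j-i a≤x)
    ev : + ∣ b - y ∣ ≡ b - y
    ev = ℤP.0≤i⇒+∣i∣≡i (ℤP.i≤j⇒0≤j-i y≤b)
    add-back : ∀ a x → a + (x - a) ≡ x
    add-back = solve-∀
    subtract-back : ∀ b y → b - (b - y) ≡ y
    subtract-back = solve-∀
    split : ∀ x y a b → (x - y) - (a - b) ≡ (x - a) + (b - y)
    split = solve-∀

open import Data.Nat using (_≥_)
open import Data.Integer using (+_; _-_; _≤_; ∣_∣) renaming (_+_ to _+ℤ_)
open import Data.Integer.Tactic.RingSolver using (solve-∀)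

CornerExtension : ℤ → ℤ → ℤ → Set
CornerExtension a b M =
    let D = Band (a - b) M
        F = λ x y → D x y × (a ≤ x × y ≤ b)
    in (t : ℤ → ℤ → ℕ) → IsPartialSL2Tiling F t → t a b ≡ 1 →
       (∀ x y → F x y → x - y ≡ M → t x y ≡ 1) →
       Σ (ℤ → ℤ → ℕ) λ s → IsFriese (a - b) M s ×
         (∀ x y → F x y → s x y ≡ t x y)

corner-extension : ∀ a b N → CornerExtension a b ((a - b) +ℤ + N)
corner-extension a b N t tiling apex hypotenuse = s , s-friese , agree
  where
  open Corner a b N t
  τ : UnitTriangle N
  τ = triangle tiling apex hypotenuse
  open GlideExtension τ using (S; friese; S-direct)
  open BandFriese friese (a - b) a
  open Cyclic (suc N) using (ρ; ρ-identity)
  agree : ∀ x y → InCorner x y → s x y ≡ t x y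
  agree x y (band , a≤x , y≤b) with corner-coordinates a≤x y≤b
  ... | x-a≡u , row , t≡T = begin
    s x y                    ≡⟨ s-value x y row (trans (cong ρ x-a≡u) (ρ-identity u≤)) ⟩
    S (u ℕ.+ v) u            ≡⟨ S-direct u v refl ⟩
    t (a +ℤ + u) (b - + v)   ≡⟨ sym t≡T ⟩
    t x y                    ∎
    where
    open ≡-Reasoning
    u = ∣ x - a ∣
    v = ∣ b - y ∣
    u≤ : u ℕ.≤ suc N
    u≤ = ℕP.≤-trans (ℕP.m≤m+n u v) (ℕP.≤-trans (row-bound x y band row) (ℕP.n≤1+n N))

-- The width n + 1 of the band is written N = suc n.
lemma7p1 : (a b : ℤ) (n : ℕ) → n ≥ 1 →
    let D = Band (a - b) ((a - b) +ℤ + n +ℤ + 1)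
        F = λ x y → D x y × (a ≤ x × y ≤ b)
    in (t : ℤ → ℤ → ℕ) → IsPartialSL2Tiling F t → t a b ≡ 1 →
       (∀ x y → F x y → x - y ≡ (a - b) +ℤ + n +ℤ + 1 → t x y ≡ 1) →
       Σ (ℤ → ℤ → ℕ) λ s → IsFriese (a - b) ((a - b) +ℤ + n +ℤ + 1) s ×
         (∀ x y → F x y → s x y ≡ t x y)
lemma7p1 a b n _ = subst (CornerExtension a b) (width (a - b) (+ n)) (corner-extension a b (suc n))
  where
  width : ∀ m n → m +ℤ (+ 1 +ℤ n) ≡ m +ℤ n +ℤ + 1
  width = solve-∀
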